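{- Let $M=(V,D)$ be a vf-closed $\Delta$-matroid with $|V|>0$. Then $Q_1(M)(-2)=0$.
   Context: A set system is $M=(V,D)$ with $V$ finite, $D$ a family of subsets of $V$; write $Z\in M$ for $Z\in D$; proper means $D\neq\emptyset$. $\oplus$ is symmetric difference. Pivot: $M*X=(V,\{Z\oplus X:Z\in D\})$; loop complementation: $M+w=(V,D\oplus\{Z\cup\{w\}:Z\in D,w\notin Z\})$; operations are applied left to right; dual pivot $M\,\bar{*}\,w=M+w*w+w$; operations on distinct elements commute, and $M\,\bar{*}\,X$ denotes applying $\bar{*}\,w$ for all $w\in X$. For proper $M$, $d_M(X)=\min\{|X\oplus Z|:Z\in M\}$, $d_M=d_M(\emptyset)$, and $Q_1(M)(y)=\sum_{X,Y\subseteq V,\,X\cap Y=\emptyset}y^{d_{M*Y\,\bar{*}\,X}}$. A $\Delta$-matroid is a proper set system such that for all $X,Y\in M$ and $w\in X\oplus Y$, either $X\oplus\{w\}\in M$ or some $v\in X\oplus Y$, $v\neq w$, has $X\oplus\{w,v\}\in M$. $M$ is a vf-closed $\Delta$-matroid if $M\varphi$ is a $\Delta$-matroid for every sequence $\varphi$ of pivots and loop complementations on elements of $V$. -}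

module Defs where

open import Data.Nat using (ℕ; zero; suc; _⊓_)
open import Data.Bool using (Bool; true; false; _xor_; _∧_; not; if_then_else_)
open import Data.Fin using (Fin)
open import Data.Fin.Subset using (Subset; _∈_; ⁅_⁆; ∣_∣; _∪_)
open import Data.Vec using (Vec; []; _∷_; zipWith; lookup)
open import Data.List using (List; []; _∷_; map; _++_; foldr; filter; concatMap; allFin)
open import Data.Integer using (ℤ; +_; -[1+_]; _+_; _^_)
open import Data.Maybe using (Maybe; just; nothing)
open import Data.Product using (Σ; _×_; _,_)
open import Data.Sum using (_⊎_)
open import Relation.Binary.PropositionalEquality using (_≡_; _≢_)
open import Relation.Nullary.Decidable using (does)
open import Relation.Unary using (Decidable)

-- Ground set V = Fin n.  A set system (V,D) is given by the
-- characteristic function of the family D ⊆ 𝒫(V).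
SetSystem : ℕ → Set
SetSystem n = Subset n → Bool

_∈M_ : ∀ {n} → Subset n → SetSystem n → Set
Z ∈M M = M Z ≡ true

_⊕_ : ∀ {n} → Subset n → Subset n → Subset n
_⊕_ = zipWith _xor_

allSubsets : ∀ n → List (Subset n)
allSubsets zero = [] ∷ []
allSubsets (suc n) = map (false ∷_) (allSubsets n) ++ map (true ∷_) (allSubsets n)

Proper : ∀ {n} → SetSystem n → Set
Proper {n} M = Σ (Subset n) λ Z → Z ∈M M

_*_ : ∀ {n} → SetSystem n → Subset n → SetSystem n
(M * X) Z = M (Z ⊕ X)

-- loop complementation M + w = (V, D ⊕ {Z ∪ {w} : Z ∈ D, w ∉ Z})
-- Z' lies in the second family iff w ∈ Z' and Z' ∖ {w} ∈ D.
_+ₗ_ : ∀ {n} → SetSystem n → Fin n → SetSystem n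
(M +ₗ w) Z = M Z xor (lookup Z w ∧ M (Z ⊕ ⁅ w ⁆))

_*ₑ_ : ∀ {n} → SetSystem n → Fin n → SetSystem n
M *ₑ w = M * ⁅ w ⁆

_*̄_ : ∀ {n} → SetSystem n → Fin n → SetSystem n
M *̄ w = ((M +ₗ w) *ₑ w) +ₗ w

_*̄ˢ_ : ∀ {n} → SetSystem n → Subset n → SetSystem n
_*̄ˢ_ {n} M X = foldr (λ w N → if lookup X w then N *̄ w else N) M (allFin n)

IsΔMatroid : ∀ {n} → SetSystem n → Set
IsΔMatroid {n} M =
  Proper M ×
  (∀ (X Y : Subset n) → X ∈M M → Y ∈M M → ∀ (w : Fin n) → w ∈ (X ⊕ Y) →
     ((X ⊕ ⁅ w ⁆) ∈M M)
     ⊎ Σ (Fin n) λ v → v ∈ (X ⊕ Y) × v ≢ w × ((X ⊕ (⁅ w ⁆ ∪ ⁅ v ⁆)) ∈M M))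

data Op (n : ℕ) : Set where
  piv  : Fin n → Op n
  loop : Fin n → Op n

applyOp : ∀ {n} → SetSystem n → Op n → SetSystem n
applyOp M (piv w) = M *ₑ w
applyOp M (loop w) = M +ₗ w

applySeq : ∀ {n} → SetSystem n → List (Op n) → SetSystem n
applySeq M [] = M
applySeq M (o ∷ φ) = applySeq (applyOp M o) φ

IsVFClosedΔMatroid : ∀ {n} → SetSystem n → Set
IsVFClosedΔMatroid {n} M = ∀ (φ : List (Op n)) → IsΔMatroid (applySeq M φ)

minM : Maybe ℕ → ℕ → Maybe ℕ
minM nothing k = just k
minM (just m) k = just (m ⊓ k)

dist : ∀ {n} → SetSystem n → Maybe ℕ
dist {n} M = foldr (λ Z acc → if M Z then minM acc ∣ Z ∣ else acc) nothing (allSubsets n)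

disjointᵇ : ∀ {n} → Subset n → Subset n → Bool
disjointᵇ [] [] = true
disjointᵇ (x ∷ X) (y ∷ Y) = not (x ∧ y) ∧ disjointᵇ X Y

disjointPairs : ∀ n → List (Subset n × Subset n)
disjointPairs n =
  concatMap (λ X → concatMap (λ Y → if disjointᵇ X Y then (X , Y) ∷ [] else []) (allSubsets n))
            (allSubsets n)

-- y^d as an integer; an improper system (d undefined) contributes 0
-- (never happens for vf-closed Δ-matroids)
powM : ℤ → Maybe ℕ → ℤ
powM y nothing = + 0
powM y (just d) = y ^ d

Q₁ : ∀ {n} → SetSystem n → ℤ → ℤ
Q₁ {n} M y = foldr (λ { (X , Y) acc → powM y (dist ((M * Y) *̄ˢ X)) + acc }) (+ 0) (disjointPairs n)

-- Split the disjoint pairs (X, Y) according to the element 0: it lies in neither set, in Y only,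
-- or in X only.  Since pivots and dual pivots on distinct elements commute, the three systems
-- M * Y *̄ X coming from one pair (X′, Y′) on the other elements are T, T * 0 and T *̄ 0, where T
-- is a Δ-matroid by vf-closedness.  Let a and b be the least sizes of the members of T avoiding
-- and containing 0, not counting 0 itself.  Then d_T = min(a, b + 1) and d_{T*0} = min(a + 1, b),
-- while the members of T *̄ 0 avoiding 0 are the sets lying in exactly one of the two fibers.
-- If a ≠ b the three distances are j, j, j + 1 in some order, with j = min(a, b); if a = b the
-- exchange axiom shows that no set of size a lies in exactly one fiber, so d_{T*̄0} = a + 1.
-- Either way the triple contributes 2(-2)^j + (-2)^(j+1) = 0.

module Submission where

open import Defs
open import Data.Nat using (ℕ; zero; suc; _≤_; _<_; s≤s; _⊓_)
open import Data.Nat.Properties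
  using (≤-refl; ≤-trans; ≤-reflexive; ≤-antisym; n≤1+n; 1+n≰n; ≤⇒≯; ≤∧≢⇒<; <-cmp; ⊓-sel; m⊓n≤m; m⊓n≤n)
open import Data.Nat.Induction using (<-wellFounded)
open import Data.Bool using (Bool; true; false; _xor_; _∧_; not; if_then_else_)
open import Data.Bool.Properties using (xor-assoc; xor-comm; xor-identityˡ; xor-identityʳ; xor-same)
open import Data.Fin using (Fin; zero; suc)
open import Data.Fin.Subset using (Subset; _∈_; ⁅_⁆; ∣_∣; _∪_; ⊥)
open import Data.Fin.Subset.Properties using (x∈⁅x⁆; x∈⁅y⁆⇒x≡y; ∪-identityˡ; ∪-identityʳ)
open import Data.Vec using ([]; _∷_; lookup)
open import Data.Vec.Properties
  using (zipWith-assoc; zipWith-comm; zipWith-identityˡ; zipWith-identityʳ; lookup-zipWith; []=⇒lookup; lookup⇒[]=)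
open import Data.Integer using (ℤ; +_; -[1+_]; _+_; _^_) renaming (_*_ to _*ℤ_)
open import Data.Integer.Properties using (+-identityˡ; +-identityʳ; +-assoc)
open import Data.Integer.Tactic.RingSolver using (solve-∀)
open import Data.Product using (Σ; _×_; _,_; proj₁; proj₂)
open import Data.Sum using (_⊎_; inj₁; inj₂)
open import Function using (_∘_; id)
open import Data.List using (List; []; _∷_; _++_; foldr; map; concatMap; tabulate; allFin)
open import Data.List.Properties using (map-tabulate; foldr-map; foldr-cong)
open import Data.List.Membership.Propositional using () renaming (_∈_ to _∈ₗ_)
open import Data.List.Membership.Propositional.Properties using (∈-map⁺; ∈-++⁺ˡ; ∈-++⁺ʳ)
open import Data.List.Relation.Unary.Any using (here; there)
open import Data.Maybe using (Maybe; just; nothing)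
open import Induction.WellFounded using (Acc; acc)
open import Relation.Binary.PropositionalEquality
open import Relation.Nullary using (¬_; contradiction)
open import Relation.Binary.Definitions using (tri<; tri≈; tri>)

≡true⊎≡false : ∀ b → b ≡ true ⊎ b ≡ false
≡true⊎≡false true  = inj₁ refl
≡true⊎≡false false = inj₂ refl

true⇒¬false : ∀ {b} → b ≡ true → ¬ b ≡ false
true⇒¬false refl ()

⊕-assoc : ∀ {n} (A B C : Subset n) → (A ⊕ B) ⊕ C ≡ A ⊕ (B ⊕ C)
⊕-assoc = zipWith-assoc xor-assoc

⊕-comm : ∀ {n} (A B : Subset n) → A ⊕ B ≡ B ⊕ A
⊕-comm = zipWith-comm xor-comm

⊕-identityˡ : ∀ {n} (A : Subset n) → ⊥ ⊕ A ≡ A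
⊕-identityˡ = zipWith-identityˡ xor-identityˡ

⊕-identityʳ : ∀ {n} (A : Subset n) → A ⊕ ⊥ ≡ A
⊕-identityʳ = zipWith-identityʳ xor-identityʳ

⊕-self : ∀ {n} (A : Subset n) → A ⊕ A ≡ ⊥
⊕-self []      = refl
⊕-self (a ∷ A) = cong₂ _∷_ (xor-same a) (⊕-self A)

⊕-cancelʳ : ∀ {n} (A B : Subset n) → (A ⊕ B) ⊕ B ≡ A
⊕-cancelʳ A B = trans (⊕-assoc A B B) (trans (cong (A ⊕_) (⊕-self B)) (⊕-identityʳ A))

⊕-swap : ∀ {n} (Z A B : Subset n) → (Z ⊕ A) ⊕ B ≡ (Z ⊕ B) ⊕ A
⊕-swap Z A B = trans (⊕-assoc Z A B) (trans (cong (Z ⊕_) (⊕-comm A B)) (sym (⊕-assoc Z B A)))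

lookup-⊕ : ∀ {n} (A B : Subset n) i → lookup (A ⊕ B) i ≡ lookup A i xor lookup B i
lookup-⊕ A B i = lookup-zipWith _xor_ i A B

lookup-⊕-∈∉ : ∀ {n} (A B : Subset n) {i} → lookup A i ≡ true → lookup B i ≡ false → lookup (A ⊕ B) i ≡ true
lookup-⊕-∈∉ A B {i} i∈A i∉B = trans (lookup-⊕ A B i) (cong₂ _xor_ i∈A i∉B)

lookup-⁅⁆-≢ : ∀ {n} {i w : Fin n} → i ≢ w → lookup ⁅ w ⁆ i ≡ false
lookup-⁅⁆-≢ {i = i} {w} i≢w with lookup ⁅ w ⁆ i in i∈w
... | false = refl
... | true  = contradiction (x∈⁅y⁆⇒x≡y w (lookup⇒[]= i ⁅ w ⁆ i∈w)) i≢w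

lookup-⊕⁅⁆-≢ : ∀ {n} (Z : Subset n) {i w} → i ≢ w → lookup (Z ⊕ ⁅ w ⁆) i ≡ lookup Z i
lookup-⊕⁅⁆-≢ Z {i} {w} i≢w =
  trans (lookup-⊕ Z ⁅ w ⁆ i) (trans (cong (lookup Z i xor_) (lookup-⁅⁆-≢ i≢w)) (xor-identityʳ _))

lookup-⊕⁅⁆-self : ∀ {n} (Z : Subset n) w → lookup (Z ⊕ ⁅ w ⁆) w ≡ not (lookup Z w)
lookup-⊕⁅⁆-self Z w =
  trans (lookup-⊕ Z ⁅ w ⁆ w) (trans (cong (lookup Z w xor_) ([]=⇒lookup (x∈⁅x⁆ w))) (xor-comm _ true))

⁅⁆∪⁅⁆≡⁅⁆⊕⁅⁆ : ∀ {n} {w v : Fin n} → v ≢ w → ⁅ w ⁆ ∪ ⁅ v ⁆ ≡ ⁅ w ⁆ ⊕ ⁅ v ⁆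
⁅⁆∪⁅⁆≡⁅⁆⊕⁅⁆ {w = zero}  {zero}  v≢w = contradiction refl v≢w
⁅⁆∪⁅⁆≡⁅⁆⊕⁅⁆ {w = zero}  {suc v} v≢w = cong (true ∷_) (trans (∪-identityˡ _) (sym (⊕-identityˡ _)))
⁅⁆∪⁅⁆≡⁅⁆⊕⁅⁆ {w = suc w} {zero}  v≢w = cong (true ∷_) (trans (∪-identityʳ _) (sym (⊕-identityʳ _)))
⁅⁆∪⁅⁆≡⁅⁆⊕⁅⁆ {w = suc w} {suc v} v≢w = cong (false ∷_) (⁅⁆∪⁅⁆≡⁅⁆⊕⁅⁆ (v≢w ∘ cong suc))

∣⊕⁅⁆∣-∈ : ∀ {n} (Z : Subset n) w → lookup Z w ≡ true → suc ∣ Z ⊕ ⁅ w ⁆ ∣ ≡ ∣ Z ∣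
∣⊕⁅⁆∣-∈ (true ∷ Z)  zero    _   = cong (suc ∘ ∣_∣) (⊕-identityʳ Z)
∣⊕⁅⁆∣-∈ (true ∷ Z)  (suc w) w∈Z = cong suc (∣⊕⁅⁆∣-∈ Z w w∈Z)
∣⊕⁅⁆∣-∈ (false ∷ Z) (suc w) w∈Z = ∣⊕⁅⁆∣-∈ Z w w∈Z

∣⊕⁅⁆∣-∉ : ∀ {n} (Z : Subset n) w → lookup Z w ≡ false → ∣ Z ⊕ ⁅ w ⁆ ∣ ≡ suc ∣ Z ∣
∣⊕⁅⁆∣-∉ (false ∷ Z) zero    _   = cong (suc ∘ ∣_∣) (⊕-identityʳ Z)
∣⊕⁅⁆∣-∉ (true ∷ Z)  (suc w) w∉Z = cong suc (∣⊕⁅⁆∣-∉ Z w w∉Z)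
∣⊕⁅⁆∣-∉ (false ∷ Z) (suc w) w∉Z = ∣⊕⁅⁆∣-∉ Z w w∉Z

≡⊎∃-∈∖∉ : ∀ {n} (W Z : Subset n) → ∣ Z ∣ ≤ ∣ W ∣ →
          W ≡ Z ⊎ Σ (Fin n) λ i → lookup W i ≡ true × lookup Z i ≡ false
≡⊎∃-∈∖∉ []          []          _         = inj₁ refl
≡⊎∃-∈∖∉ (true ∷ W)  (false ∷ Z) _         = inj₂ (zero , refl , refl)
≡⊎∃-∈∖∉ (true ∷ W)  (true ∷ Z)  (s≤s Z≤W) with ≡⊎∃-∈∖∉ W Z Z≤W
... | inj₁ refl             = inj₁ refl
... | inj₂ (i , i∈W , i∉Z) = inj₂ (suc i , i∈W , i∉Z)
≡⊎∃-∈∖∉ (false ∷ W) (false ∷ Z) Z≤W       with ≡⊎∃-∈∖∉ W Z Z≤W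
... | inj₁ refl             = inj₁ refl
... | inj₂ (i , i∈W , i∉Z) = inj₂ (suc i , i∈W , i∉Z)
≡⊎∃-∈∖∉ (false ∷ W) (true ∷ Z)  Z≤W       with ≡⊎∃-∈∖∉ W Z (≤-trans (n≤1+n _) Z≤W)
... | inj₁ refl             = contradiction Z≤W 1+n≰n
... | inj₂ (i , i∈W , i∉Z) = inj₂ (suc i , i∈W , i∉Z)

∷-⊕-⁅zero⁆ : ∀ {n} b (Z : Subset n) → (b ∷ Z) ⊕ ⁅ zero ⁆ ≡ not b ∷ Z
∷-⊕-⁅zero⁆ b Z = cong₂ _∷_ (xor-comm b true) (⊕-identityʳ Z)

∷-⊕-⁅suc⁆ : ∀ {n} b (Z : Subset n) w → (b ∷ Z) ⊕ ⁅ suc w ⁆ ≡ b ∷ (Z ⊕ ⁅ w ⁆)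
∷-⊕-⁅suc⁆ b Z w = cong (_∷ (Z ⊕ ⁅ w ⁆)) (xor-identityʳ b)

⊕-⁅⁆∪⁅⁆ : ∀ {n} (Z : Subset n) {w v} → v ≢ w → Z ⊕ (⁅ w ⁆ ∪ ⁅ v ⁆) ≡ (Z ⊕ ⁅ w ⁆) ⊕ ⁅ v ⁆
⊕-⁅⁆∪⁅⁆ Z {w} {v} v≢w = trans (cong (Z ⊕_) (⁅⁆∪⁅⁆≡⁅⁆⊕⁅⁆ v≢w)) (sym (⊕-assoc Z ⁅ w ⁆ ⁅ v ⁆))

∣⊕⁅⁆⊕⁅⁆∣-∈ : ∀ {n} (Z : Subset n) {i j} → lookup Z i ≡ true → lookup Z j ≡ true → j ≢ i →
              suc (suc ∣ (Z ⊕ ⁅ i ⁆) ⊕ ⁅ j ⁆ ∣) ≡ ∣ Z ∣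
∣⊕⁅⁆⊕⁅⁆∣-∈ Z {i} {j} i∈Z j∈Z j≢i =
  trans (cong suc (∣⊕⁅⁆∣-∈ (Z ⊕ ⁅ i ⁆) j (trans (lookup-⊕⁅⁆-≢ Z j≢i) j∈Z))) (∣⊕⁅⁆∣-∈ Z i i∈Z)

*-≗ : ∀ {n} {P Q : SetSystem n} (A : Subset n) → P ≗ Q → (P * A) ≗ (Q * A)
*-≗ A P≗Q Z = P≗Q (Z ⊕ A)

+ₗ-≗ : ∀ {n} {P Q : SetSystem n} w → P ≗ Q → (P +ₗ w) ≗ (Q +ₗ w)
+ₗ-≗ w P≗Q Z = cong₂ (λ a b → a xor (lookup Z w ∧ b)) (P≗Q Z) (P≗Q (Z ⊕ ⁅ w ⁆))

*̄-≗ : ∀ {n} {P Q : SetSystem n} w → P ≗ Q → (P *̄ w) ≗ (Q *̄ w)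
*̄-≗ w = +ₗ-≗ w ∘ *-≗ ⁅ w ⁆ ∘ +ₗ-≗ w

*-* : ∀ {n} (P : SetSystem n) (A B : Subset n) → ((P * A) * B) ≗ (P * (B ⊕ A))
*-* P A B Z = cong P (⊕-assoc Z B A)

*̄-∈ : ∀ {n} (P : SetSystem n) {w Z} → lookup Z w ≡ true → (P *̄ w) Z ≡ P Z
*̄-∈ P {w} {Z} w∈Z
  rewrite w∈Z | lookup-⊕⁅⁆-self Z w | w∈Z | ⊕-cancelʳ Z ⁅ w ⁆ | w∈Z
  = cancel (P (Z ⊕ ⁅ w ⁆)) (P Z)
  where
  cancel : ∀ a b → (a xor false) xor (b xor a) ≡ b
  cancel true  true  = refl
  cancel true  false = refl
  cancel false b     = xor-identityʳ b

*̄-∉ : ∀ {n} (P : SetSystem n) {w Z} → lookup Z w ≡ false → (P *̄ w) Z ≡ P Z xor P (Z ⊕ ⁅ w ⁆)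
*̄-∉ P {w} {Z} w∉Z
  rewrite lookup-⊕⁅⁆-self Z w | w∉Z | ⊕-cancelʳ Z ⁅ w ⁆
  = trans (xor-identityʳ _) (xor-comm (P (Z ⊕ ⁅ w ⁆)) (P Z))

*ₑ-*̄-comm : ∀ {n} (P : SetSystem n) {u w} → w ≢ u → ((P *ₑ u) *̄ w) ≗ ((P *̄ w) *ₑ u)
*ₑ-*̄-comm P {u} {w} w≢u Z with ≡true⊎≡false (lookup Z w)
... | inj₁ Z∋w = trans (*̄-∈ (P *ₑ u) Z∋w) (sym (*̄-∈ P (trans (lookup-⊕⁅⁆-≢ Z w≢u) Z∋w)))
... | inj₂ Z∌w = trans (*̄-∉ (P *ₑ u) Z∌w)
             (trans (cong (λ V → P (Z ⊕ ⁅ u ⁆) xor P V) (⊕-swap Z ⁅ w ⁆ ⁅ u ⁆))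
                    (sym (*̄-∉ P (trans (lookup-⊕⁅⁆-≢ Z w≢u) Z∌w))))

_*̄ˢ-suc_ : ∀ {m} → SetSystem (suc m) → Subset m → SetSystem (suc m)
_*̄ˢ-suc_ {m} K X = foldr (λ w N → if lookup X w then N *̄ suc w else N) K (allFin m)

foldr-tabulate-suc : ∀ {A : Set} {m} (f : Fin (suc m) → A → A) e →
                     foldr f e (tabulate {n = m} suc) ≡ foldr (f ∘ suc) e (allFin m)
foldr-tabulate-suc {m = m} f e =
  trans (cong (foldr f e) (sym (map-tabulate id suc))) (foldr-map f suc e (allFin m))

*̄ˢ-false∷ : ∀ {m} (K : SetSystem (suc m)) X → K *̄ˢ (false ∷ X) ≡ K *̄ˢ-suc X
*̄ˢ-false∷ K X = foldr-tabulate-suc (λ w N → if lookup (false ∷ X) w then N *̄ w else N) K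

*̄ˢ-true∷ : ∀ {m} (K : SetSystem (suc m)) X → K *̄ˢ (true ∷ X) ≡ (K *̄ˢ-suc X) *̄ zero
*̄ˢ-true∷ K X = cong (_*̄ zero) (foldr-tabulate-suc (λ w N → if lookup (true ∷ X) w then N *̄ w else N) K)

*̄ˢ-suc-*ₑzero : ∀ {m} {K K′ : SetSystem (suc m)} X → K′ ≗ (K *ₑ zero) →
                (K′ *̄ˢ-suc X) ≗ ((K *̄ˢ-suc X) *ₑ zero)
*̄ˢ-suc-*ₑzero {m} {K} {K′} X K′≗ = go (allFin m)
  where
  dualPivot : Fin m → SetSystem (suc m) → SetSystem (suc m)
  dualPivot w N = if lookup X w then N *̄ suc w else N

  go : ∀ L → foldr dualPivot K′ L ≗ (foldr dualPivot K L *ₑ zero)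
  go []      = K′≗
  go (w ∷ L) with lookup X w
  ... | true  = λ Z → trans (*̄-≗ (suc w) (go L) Z) (*ₑ-*̄-comm (foldr dualPivot K L) {zero} (λ ()) Z)
  ... | false = go L

applyOp-≗ : ∀ {n} {P Q : SetSystem n} o → P ≗ Q → applyOp P o ≗ applyOp Q o
applyOp-≗ (piv w)  = *-≗ ⁅ w ⁆
applyOp-≗ (loop w) = +ₗ-≗ w

applySeq-≗ : ∀ {n} {P Q : SetSystem n} φ → P ≗ Q → applySeq P φ ≗ applySeq Q φ
applySeq-≗ []      P≗Q = P≗Q
applySeq-≗ (o ∷ φ) P≗Q = applySeq-≗ φ (applyOp-≗ o P≗Q)

applySeq-++ : ∀ {n} (P : SetSystem n) φ ψ → applySeq P (φ ++ ψ) ≡ applySeq (applySeq P φ) ψ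
applySeq-++ P []      ψ = refl
applySeq-++ P (o ∷ φ) ψ = applySeq-++ (applyOp P o) φ ψ

isΔMatroid-≗ : ∀ {n} {P Q : SetSystem n} → P ≗ Q → IsΔMatroid P → IsΔMatroid Q
isΔMatroid-≗ {P = P} {Q} P≗Q ((Z , Z∈P) , exchange) = (Z , trans (sym (P≗Q Z)) Z∈P) , exchangeQ
  where
  exchangeQ : ∀ X Y → X ∈M Q → Y ∈M Q → ∀ w → w ∈ (X ⊕ Y) →
              (X ⊕ ⁅ w ⁆) ∈M Q ⊎ Σ (Fin _) λ v → v ∈ (X ⊕ Y) × v ≢ w × (X ⊕ (⁅ w ⁆ ∪ ⁅ v ⁆)) ∈M Q
  exchangeQ X Y X∈Q Y∈Q w w∈ with exchange X Y (trans (P≗Q X) X∈Q) (trans (P≗Q Y) Y∈Q) w w∈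
  ... | inj₁ X⊕w∈P                 = inj₁ (trans (sym (P≗Q _)) X⊕w∈P)
  ... | inj₂ (v , v∈ , v≢w , X⊕wv∈P) = inj₂ (v , v∈ , v≢w , trans (sym (P≗Q _)) X⊕wv∈P)

vfClosed-≗ : ∀ {n} {P Q : SetSystem n} → P ≗ Q → IsVFClosedΔMatroid P → IsVFClosedΔMatroid Q
vfClosed-≗ P≗Q vf φ = isΔMatroid-≗ (applySeq-≗ φ P≗Q) (vf φ)

vfClosed-applySeq : ∀ {n} {P : SetSystem n} φ → IsVFClosedΔMatroid P → IsVFClosedΔMatroid (applySeq P φ)
vfClosed-applySeq {P = P} φ vf ψ = subst IsΔMatroid (applySeq-++ P φ ψ) (vf (φ ++ ψ))

vfClosed-*̄ : ∀ {n} {P : SetSystem n} w → IsVFClosedΔMatroid P → IsVFClosedΔMatroid (P *̄ w)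
vfClosed-*̄ w = vfClosed-applySeq (loop w ∷ piv w ∷ loop w ∷ [])

vfClosed-*̄ˢ : ∀ {n} {K : SetSystem n} X → IsVFClosedΔMatroid K → IsVFClosedΔMatroid (K *̄ˢ X)
vfClosed-*̄ˢ {n} {K} X vf = go (allFin n)
  where
  go : ∀ L → IsVFClosedΔMatroid (foldr (λ w N → if lookup X w then N *̄ w else N) K L)
  go []      = vf
  go (w ∷ L) with lookup X w
  ... | true  = vfClosed-*̄ w (go L)
  ... | false = go L

⨁ : ∀ {n} → List (Fin n) → Subset n
⨁ []      = ⊥
⨁ (w ∷ L) = ⨁ L ⊕ ⁅ w ⁆

elements : ∀ {n} → Subset n → List (Fin n)
elements []          = []
elements (true ∷ A)  = zero ∷ map suc (elements A)
elements (false ∷ A) = map suc (elements A)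

⨁-map-suc : ∀ {n} (L : List (Fin n)) → ⨁ (map suc L) ≡ false ∷ ⨁ L
⨁-map-suc []      = refl
⨁-map-suc (w ∷ L) = cong (_⊕ ⁅ suc w ⁆) (⨁-map-suc L)

⨁-elements : ∀ {n} (A : Subset n) → ⨁ (elements A) ≡ A
⨁-elements []          = refl
⨁-elements (true ∷ A)  =
  trans (cong (_⊕ ⁅ zero ⁆) (⨁-map-suc (elements A))) (cong (true ∷_) (trans (⊕-identityʳ _) (⨁-elements A)))
⨁-elements (false ∷ A) = trans (⨁-map-suc (elements A)) (cong (false ∷_) (⨁-elements A))

applySeq-pivots : ∀ {n} (P : SetSystem n) L → applySeq P (map piv L) ≗ (P * ⨁ L)
applySeq-pivots P []      Z = cong P (sym (⊕-identityʳ Z))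
applySeq-pivots P (w ∷ L) Z = trans (applySeq-pivots (P *ₑ w) L Z) (*-* P ⁅ w ⁆ (⨁ L) Z)

vfClosed-* : ∀ {n} {P : SetSystem n} A → IsVFClosedΔMatroid P → IsVFClosedΔMatroid (P * A)
vfClosed-* {P = P} A vf =
  vfClosed-≗ (λ Z → trans (applySeq-pivots P (elements A) Z) (cong (λ B → P (Z ⊕ B)) (⨁-elements A)))
             (vfClosed-applySeq (map piv (elements A)) vf)

LowerBound : ∀ {n} → SetSystem n → ℕ → Set
LowerBound P d = ∀ Z → Z ∈M P → d ≤ ∣ Z ∣

Attains : ∀ {n} → SetSystem n → ℕ → Set
Attains {n} P d = Σ (Subset n) λ Z → Z ∈M P × ∣ Z ∣ ≡ d

data MinimumOn {n} (P : SetSystem n) (L : List (Subset n)) : Maybe ℕ → Set where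
  none : (∀ {Z} → Z ∈ₗ L → P Z ≡ false) → MinimumOn P L nothing
  some : ∀ {d} → Attains P d → (∀ {Z} → Z ∈ₗ L → Z ∈M P → d ≤ ∣ Z ∣) → MinimumOn P L (just d)

minimumOn : ∀ {n} (P : SetSystem n) L →
            MinimumOn P L (foldr (λ Z acc → if P Z then minM acc ∣ Z ∣ else acc) nothing L)
minimumOn P []      = none (λ ())
minimumOn P (Z ∷ L) with P Z in PZ | foldr (λ Z acc → if P Z then minM acc ∣ Z ∣ else acc) nothing L | minimumOn P L
... | false | _ | none L∌ = none λ { (here refl) → PZ ; (there Y∈L) → L∌ Y∈L }
... | false | _ | some attained lb = some attained λ
  { (here refl) Z∈P → contradiction PZ (true⇒¬false Z∈P)
  ; (there Y∈L) → lb Y∈L }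
... | true | _ | none L∌ = some (Z , PZ , refl) λ
  { (here refl) _ → ≤-refl
  ; (there Y∈L) Y∈P → contradiction (L∌ Y∈L) (true⇒¬false Y∈P) }
... | true | _ | some {d} (W , W∈P , ∣W∣≡d) lb = some attainedMin λ
  { (here refl) _ → m⊓n≤n d ∣ Z ∣
  ; (there Y∈L) Y∈P → ≤-trans (m⊓n≤m d ∣ Z ∣) (lb Y∈L Y∈P) }
  where
  attainedMin : Attains P (d ⊓ ∣ Z ∣)
  attainedMin with ⊓-sel d ∣ Z ∣
  ... | inj₁ d⊓≡d   = W , W∈P , trans ∣W∣≡d (sym d⊓≡d)
  ... | inj₂ d⊓≡∣Z∣ = Z , PZ , sym d⊓≡∣Z∣

∈-allSubsets : ∀ {n} (Z : Subset n) → Z ∈ₗ allSubsets n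
∈-allSubsets []          = here refl
∈-allSubsets (false ∷ Z) = ∈-++⁺ˡ (∈-map⁺ (false ∷_) (∈-allSubsets Z))
∈-allSubsets (true ∷ Z)  = ∈-++⁺ʳ _ (∈-map⁺ (true ∷_) (∈-allSubsets Z))

dist-≡ : ∀ {n} {P : SetSystem n} {d} → Attains P d → LowerBound P d → dist P ≡ just d
dist-≡ {n} {P} (Z , Z∈P , refl) lb with dist P | minimumOn P (allSubsets n)
... | nothing | none L∌                    = contradiction (L∌ (∈-allSubsets Z)) (true⇒¬false Z∈P)
... | just _  | some (W , W∈P , refl) lbL = cong just (≤-antisym (lbL (∈-allSubsets Z) Z∈P) (lb W W∈P))

empty⊎minimum : ∀ {n} (P : SetSystem n) → (∀ Z → P Z ≡ false) ⊎ Σ ℕ λ d → Attains P d × LowerBound P d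
empty⊎minimum {n} P with dist P | minimumOn P (allSubsets n)
... | nothing | none L∌          = inj₁ (λ Z → L∌ (∈-allSubsets Z))
... | just _  | some attained lb = inj₂ (_ , attained , λ Z → lb (∈-allSubsets Z))

dist-≗ : ∀ {n} {P Q : SetSystem n} → P ≗ Q → dist P ≡ dist Q
dist-≗ {n} P≗Q =
  foldr-cong (λ Z acc → cong (λ b → if b then minM acc ∣ Z ∣ else acc) (P≗Q Z)) refl (allSubsets n)

fiber : ∀ {m} → Bool → SetSystem (suc m) → SetSystem m
fiber b N Z = N (b ∷ Z)

_⊻_ : ∀ {n} → SetSystem n → SetSystem n → SetSystem n
(P ⊻ Q) Z = P Z xor Q Z

fiber-*ₑzero : ∀ {m} b (N : SetSystem (suc m)) → fiber (not b) N ≗ fiber b (N *ₑ zero)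
fiber-*ₑzero b N Z = cong N (sym (∷-⊕-⁅zero⁆ b Z))

fiber-true-*̄zero : ∀ {m} (N : SetSystem (suc m)) → fiber true N ≗ fiber true (N *̄ zero)
fiber-true-*̄zero N Z = sym (*̄-∈ N {zero} refl)

fiber-false-*̄zero : ∀ {m} (N : SetSystem (suc m)) → (fiber false N ⊻ fiber true N) ≗ fiber false (N *̄ zero)
fiber-false-*̄zero N Z = sym (trans (*̄-∉ N {zero} refl) (cong (λ V → N (false ∷ Z) xor N V) (∷-⊕-⁅zero⁆ false Z)))

lowerBound-≗ : ∀ {n} {P Q : SetSystem n} {d} → P ≗ Q → LowerBound P d → LowerBound Q d
lowerBound-≗ P≗Q lb Z Z∈Q = lb Z (trans (P≗Q Z) Z∈Q)

attains-≗ : ∀ {n} {P Q : SetSystem n} {d} → P ≗ Q → Attains P d → Attains Q d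
attains-≗ P≗Q (Z , Z∈P , ∣Z∣≡d) = Z , trans (sym (P≗Q Z)) Z∈P , ∣Z∣≡d

lowerBound-weaken : ∀ {n} {P : SetSystem n} {d e} → d ≤ e → LowerBound P e → LowerBound P d
lowerBound-weaken d≤e lb Z Z∈P = ≤-trans d≤e (lb Z Z∈P)

lowerBound-empty : ∀ {n} {P : SetSystem n} {d} → (∀ Z → P Z ≡ false) → LowerBound P d
lowerBound-empty P∅ Z Z∈P = contradiction (P∅ Z) (true⇒¬false Z∈P)

∉-below-lowerBound : ∀ {n} {P : SetSystem n} {d} Z → LowerBound P d → ∣ Z ∣ < d → P Z ≡ false
∉-below-lowerBound {P = P} Z lb ∣Z∣<d with ≡true⊎≡false (P Z)
... | inj₁ Z∈P = contradiction ∣Z∣<d (≤⇒≯ (lb Z Z∈P))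
... | inj₂ Z∉P = Z∉P

lowerBound-⊻ : ∀ {n} {P Q : SetSystem n} {d} → LowerBound P d → LowerBound Q d → LowerBound (P ⊻ Q) d
lowerBound-⊻ {P = P} lbP lbQ Z Z∈P⊻Q with ≡true⊎≡false (P Z)
... | inj₁ Z∈P = lbP Z Z∈P
... | inj₂ Z∉P = lbQ Z (trans (sym (cong (_xor _) Z∉P)) Z∈P⊻Q)

attains-⊻ˡ : ∀ {n} {P Q : SetSystem n} {d} → Attains P d → LowerBound Q (suc d) → Attains (P ⊻ Q) d
attains-⊻ˡ (Z , Z∈P , refl) lbQ =
  Z , cong₂ _xor_ Z∈P (∉-below-lowerBound Z lbQ ≤-refl) , refl

attains-⊻ʳ : ∀ {n} {P Q : SetSystem n} {d} → LowerBound P (suc d) → Attains Q d → Attains (P ⊻ Q) d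
attains-⊻ʳ lbP (Z , Z∈Q , refl) =
  Z , cong₂ _xor_ (∉-below-lowerBound Z lbP ≤-refl) Z∈Q , refl

attains-fiber-false : ∀ {m} {N : SetSystem (suc m)} {d} → Attains (fiber false N) d → Attains N d
attains-fiber-false (Z , Z∈ , ∣Z∣≡d) = false ∷ Z , Z∈ , ∣Z∣≡d

attains-fiber-true : ∀ {m} {N : SetSystem (suc m)} {d} → Attains (fiber true N) d → Attains N (suc d)
attains-fiber-true (Z , Z∈ , ∣Z∣≡d) = true ∷ Z , Z∈ , cong suc ∣Z∣≡d

dist-fibers : ∀ {m} (N : SetSystem (suc m)) {d e} → Attains N d →
              LowerBound (fiber false N) d → LowerBound (fiber true N) e → d ≤ suc e → dist N ≡ just d
dist-fibers N attained lbF lbT d≤1+e = dist-≡ attained lowerBound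
  where
  lowerBound : LowerBound N _
  lowerBound (false ∷ Z) Z∈ = lbF Z Z∈
  lowerBound (true ∷ Z)  Z∈ = ≤-trans d≤1+e (s≤s (lbT Z Z∈))

module _ {m} {N : SetSystem (suc m)} (isΔ : IsΔMatroid N) {a : ℕ}
         (lb : ∀ b → LowerBound (fiber b N) a) where

  -- Walk W towards Z: the exchange axiom for c ∷ W and not c ∷ Z at some i ∈ W ∖ Z either yields
  -- a member whose tail has fewer than a elements, or a member c ∷ W′ with ∣ W′ ∣ = a and W′ ⊕ Z
  -- two elements smaller than W ⊕ Z.
  minimal-fiber-exchange : ∀ c {Z W} → ∣ Z ∣ ≡ a → ∣ W ∣ ≡ a →
                           (c ∷ W) ∈M N → (not c ∷ Z) ∈M N → (c ∷ Z) ∈M N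
  minimal-fiber-exchange c {Z} ∣Z∣≡a ∣W∣≡a W∈ Z∈ = go (<-wellFounded _) ∣W∣≡a W∈
    where
    below : ∀ b {Y} → (b ∷ Y) ∈M N → ¬ ∣ Y ∣ < a
    below b {Y} Y∈ = ≤⇒≯ (lb b Y Y∈)

    ∉-after-removal : ∀ b {W} i → lookup W i ≡ true → ∣ W ∣ ≡ a → ¬ (b ∷ (W ⊕ ⁅ i ⁆)) ∈M N
    ∉-after-removal b {W} i i∈W ∣W∣≡a W-i∈ = below b W-i∈ (≤-reflexive (trans (∣⊕⁅⁆∣-∈ W i i∈W) ∣W∣≡a))

    go : ∀ {W} → Acc _<_ ∣ W ⊕ Z ∣ → ∣ W ∣ ≡ a → (c ∷ W) ∈M N → (c ∷ Z) ∈M N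
    go {W} (acc smaller) ∣W∣≡a W∈ with ≡⊎∃-∈∖∉ W Z (≤-reflexive (trans ∣Z∣≡a (sym ∣W∣≡a)))
    ... | inj₁ refl = W∈
    ... | inj₂ (i , i∈W , i∉Z)
        with proj₂ isΔ (c ∷ W) (not c ∷ Z) W∈ Z∈ (suc i) (lookup⇒[]= (suc i) _ (lookup-⊕-∈∉ W Z i∈W i∉Z))
    ... | inj₁ e = contradiction (subst (_∈M N) (∷-⊕-⁅suc⁆ c W i) e) (∉-after-removal c i i∈W ∣W∣≡a)
    ... | inj₂ (zero , _ , _ , e) = contradiction (subst (_∈M N) W-i≡ e) (∉-after-removal (not c) i i∈W ∣W∣≡a)
      where
      W-i≡ : (c ∷ W) ⊕ (⁅ suc i ⁆ ∪ ⁅ zero ⁆) ≡ not c ∷ (W ⊕ ⁅ i ⁆)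
      W-i≡ = trans (⊕-⁅⁆∪⁅⁆ (c ∷ W) {suc i} {zero} λ ())
                   (trans (cong (_⊕ ⁅ zero ⁆) (∷-⊕-⁅suc⁆ c W i)) (∷-⊕-⁅zero⁆ c _))
    ... | inj₂ (suc j , j∈ , sj≢si , e) = exchanged (≡true⊎≡false (lookup W j))
      where
      j≢i : j ≢ i
      j≢i = sj≢si ∘ cong suc
      W′ : Subset m
      W′ = (W ⊕ ⁅ i ⁆) ⊕ ⁅ j ⁆
      W′≡ : (c ∷ W) ⊕ (⁅ suc i ⁆ ∪ ⁅ suc j ⁆) ≡ c ∷ W′
      W′≡ = trans (⊕-⁅⁆∪⁅⁆ (c ∷ W) sj≢si)
                  (trans (cong (_⊕ ⁅ suc j ⁆) (∷-⊕-⁅suc⁆ c W i)) (∷-⊕-⁅suc⁆ c _ j))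
      W′∈ : (c ∷ W′) ∈M N
      W′∈ = subst (_∈M N) W′≡ e
      exchanged : lookup W j ≡ true ⊎ lookup W j ≡ false → (c ∷ Z) ∈M N
      exchanged (inj₁ j∈W) = contradiction ∣W′∣<a (below c W′∈)
        where
        ∣W′∣<a : ∣ W′ ∣ < a
        ∣W′∣<a = ≤-trans (n≤1+n _) (≤-reflexive (trans (∣⊕⁅⁆⊕⁅⁆∣-∈ W i∈W j∈W j≢i) ∣W∣≡a))
      exchanged (inj₂ j∉W) = go (smaller closer) ∣W′∣≡a W′∈
        where
        ∣W′∣≡a : ∣ W′ ∣ ≡ a
        ∣W′∣≡a = trans (∣⊕⁅⁆∣-∉ (W ⊕ ⁅ i ⁆) j (trans (lookup-⊕⁅⁆-≢ W j≢i) j∉W))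
                       (trans (∣⊕⁅⁆∣-∈ W i i∈W) ∣W∣≡a)
        W′⊕Z≡ : W′ ⊕ Z ≡ ((W ⊕ Z) ⊕ ⁅ i ⁆) ⊕ ⁅ j ⁆
        W′⊕Z≡ = trans (⊕-swap (W ⊕ ⁅ i ⁆) ⁅ j ⁆ Z) (cong (_⊕ ⁅ j ⁆) (⊕-swap W ⁅ i ⁆ Z))
        closer : ∣ W′ ⊕ Z ∣ < ∣ W ⊕ Z ∣
        closer = ≤-trans (n≤1+n _) (≤-reflexive (trans (cong (λ V → suc (suc ∣ V ∣)) W′⊕Z≡)
                   (∣⊕⁅⁆⊕⁅⁆∣-∈ (W ⊕ Z) (lookup-⊕-∈∉ W Z i∈W i∉Z) ([]=⇒lookup j∈) j≢i)))

  lowerBound-⊻-fibers : Attains (fiber false N) a → Attains (fiber true N) a →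
                        LowerBound (fiber false N ⊻ fiber true N) (suc a)
  lowerBound-⊻-fibers (Wf , Wf∈ , ∣Wf∣≡a) (Wt , Wt∈ , ∣Wt∣≡a) Z Z∈
    with ≡true⊎≡false (N (false ∷ Z)) | ≡true⊎≡false (N (true ∷ Z))
  ... | inj₁ F∋Z | inj₁ T∋Z = contradiction (cong₂ _xor_ F∋Z T∋Z) (true⇒¬false Z∈)
  ... | inj₂ F∌Z | inj₂ T∌Z = contradiction (cong₂ _xor_ F∌Z T∌Z) (true⇒¬false Z∈)
  ... | inj₁ F∋Z | inj₂ T∌Z = ≤∧≢⇒< (lb false Z F∋Z) λ a≡∣Z∣ →
    true⇒¬false (minimal-fiber-exchange true (sym a≡∣Z∣) ∣Wt∣≡a Wt∈ F∋Z) T∌Z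
  ... | inj₂ F∌Z | inj₁ T∋Z = ≤∧≢⇒< (lb true Z T∋Z) λ a≡∣Z∣ →
    true⇒¬false (minimal-fiber-exchange false (sym a≡∣Z∣) ∣Wf∣≡a Wf∈ T∋Z) F∌Z

dist-*ₑzero : ∀ {m} (N : SetSystem (suc m)) {d e} → Attains (N *ₑ zero) d →
              LowerBound (fiber true N) d → LowerBound (fiber false N) e → d ≤ suc e → dist (N *ₑ zero) ≡ just d
dist-*ₑzero N attained lbT lbF =
  dist-fibers (N *ₑ zero) attained (lowerBound-≗ (fiber-*ₑzero false N) lbT) (lowerBound-≗ (fiber-*ₑzero true N) lbF)

dist-*̄zero : ∀ {m} (N : SetSystem (suc m)) {d e} → Attains (N *̄ zero) d →
             LowerBound (fiber false N ⊻ fiber true N) d → LowerBound (fiber true N) e → d ≤ suc e →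
             dist (N *̄ zero) ≡ just d
dist-*̄zero N attained lb⊻ lbT =
  dist-fibers (N *̄ zero) attained (lowerBound-≗ (fiber-false-*̄zero N) lb⊻) (lowerBound-≗ (fiber-true-*̄zero N) lbT)

data OneExceedsByOne (d₁ d₂ d₃ : Maybe ℕ) : Set where
  first  : ∀ j → d₁ ≡ just (suc j) → d₂ ≡ just j → d₃ ≡ just j → OneExceedsByOne d₁ d₂ d₃
  second : ∀ j → d₁ ≡ just j → d₂ ≡ just (suc j) → d₃ ≡ just j → OneExceedsByOne d₁ d₂ d₃
  third  : ∀ j → d₁ ≡ just j → d₂ ≡ just j → d₃ ≡ just (suc j) → OneExceedsByOne d₁ d₂ d₃

module _ {m} {N : SetSystem (suc m)} where

  false-fiber-smaller : ∀ {a} → Attains (fiber false N) a → LowerBound (fiber false N) a →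
                        LowerBound (fiber true N) (suc a) →
                        OneExceedsByOne (dist N) (dist (N *ₑ zero)) (dist (N *̄ zero))
  false-fiber-smaller {a} attF lbF lbT = second a
    (dist-fibers N (attains-fiber-false attF) lbF lbT a≤2+a)
    (dist-*ₑzero N (attains-fiber-true (attains-≗ (fiber-*ₑzero true N) attF)) lbT lbF ≤-refl)
    (dist-*̄zero N (attains-fiber-false (attains-≗ (fiber-false-*̄zero N) (attains-⊻ˡ attF lbT)))
                (lowerBound-⊻ lbF (lowerBound-weaken (n≤1+n a) lbT)) lbT a≤2+a)
    where
    a≤2+a : a ≤ suc (suc a)
    a≤2+a = ≤-trans (n≤1+n a) (n≤1+n _)

  true-fiber-smaller : ∀ {b} → Attains (fiber true N) b → LowerBound (fiber true N) b →
                       LowerBound (fiber false N) (suc b) →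
                       OneExceedsByOne (dist N) (dist (N *ₑ zero)) (dist (N *̄ zero))
  true-fiber-smaller {b} attT lbT lbF = first b
    (dist-fibers N (attains-fiber-true attT) lbF lbT ≤-refl)
    (dist-*ₑzero N (attains-fiber-false (attains-≗ (fiber-*ₑzero false N) attT)) lbT lbF
                 (≤-trans (n≤1+n b) (n≤1+n _)))
    (dist-*̄zero N (attains-fiber-false (attains-≗ (fiber-false-*̄zero N) (attains-⊻ʳ lbF attT)))
                (lowerBound-⊻ (lowerBound-weaken (n≤1+n b) lbF) lbT) lbT (n≤1+n b))

  equal-fibers : IsΔMatroid N → ∀ {a} → Attains (fiber false N) a → Attains (fiber true N) a →
                 LowerBound (fiber false N) a → LowerBound (fiber true N) a →
                 OneExceedsByOne (dist N) (dist (N *ₑ zero)) (dist (N *̄ zero))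
  equal-fibers isΔ {a} attF attT lbF lbT = third a
    (dist-fibers N (attains-fiber-false attF) lbF lbT (n≤1+n a))
    (dist-*ₑzero N (attains-fiber-false (attains-≗ (fiber-*ₑzero false N) attT)) lbT lbF (n≤1+n a))
    (dist-*̄zero N (attains-fiber-true (attains-≗ (fiber-true-*̄zero N) attT))
                (lowerBound-⊻-fibers {N = N} isΔ lb attF attT) lbT ≤-refl)
    where
    lb : ∀ b → LowerBound (fiber b N) a
    lb false = lbF
    lb true  = lbT

  dists-OneExceedsByOne : IsΔMatroid N → OneExceedsByOne (dist N) (dist (N *ₑ zero)) (dist (N *̄ zero))
  dists-OneExceedsByOne isΔ with empty⊎minimum (fiber false N) | empty⊎minimum (fiber true N)
  ... | inj₁ F∅ | inj₁ T∅ with proj₁ isΔ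
  ...   | false ∷ Z , Z∈ = contradiction (F∅ Z) (true⇒¬false Z∈)
  ...   | true ∷ Z  , Z∈ = contradiction (T∅ Z) (true⇒¬false Z∈)
  dists-OneExceedsByOne isΔ | inj₂ (a , attF , lbF) | inj₁ T∅ = false-fiber-smaller attF lbF (lowerBound-empty T∅)
  dists-OneExceedsByOne isΔ | inj₁ F∅ | inj₂ (b , attT , lbT) = true-fiber-smaller attT lbT (lowerBound-empty F∅)
  dists-OneExceedsByOne isΔ | inj₂ (a , attF , lbF) | inj₂ (b , attT , lbT) with <-cmp a b
  ... | tri< a<b _ _ = false-fiber-smaller attF lbF (lowerBound-weaken a<b lbT)
  ... | tri> _ _ b<a = true-fiber-smaller attT lbT (lowerBound-weaken b<a lbF)
  ... | tri≈ _ refl _ = equal-fibers isΔ attF attT lbF lbT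

cancel-−2-powers : ∀ {d₁ d₂ d₃} → OneExceedsByOne d₁ d₂ d₃ →
                   powM -[1+ 1 ] d₁ + powM -[1+ 1 ] d₂ + powM -[1+ 1 ] d₃ ≡ + 0
cancel-−2-powers (first  j refl refl refl) = cancel₁ (-[1+ 1 ] ^ j)
  where
  cancel₁ : ∀ x → -[1+ 1 ] *ℤ x + x + x ≡ + 0
  cancel₁ = solve-∀
cancel-−2-powers (second j refl refl refl) = cancel₂ (-[1+ 1 ] ^ j)
  where
  cancel₂ : ∀ x → x + -[1+ 1 ] *ℤ x + x ≡ + 0
  cancel₂ = solve-∀
cancel-−2-powers (third  j refl refl refl) = cancel₃ (-[1+ 1 ] ^ j)
  where
  cancel₃ : ∀ x → x + x + -[1+ 1 ] *ℤ x ≡ + 0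
  cancel₃ = solve-∀

∑ : ∀ {A : Set} → List A → (A → ℤ) → ℤ
∑ xs f = foldr (λ x acc → f x + acc) (+ 0) xs

∑-++ : ∀ {A : Set} (xs ys : List A) f → ∑ (xs ++ ys) f ≡ ∑ xs f + ∑ ys f
∑-++ []       ys f = sym (+-identityˡ _)
∑-++ (x ∷ xs) ys f = trans (cong (λ s → f x + s) (∑-++ xs ys f)) (sym (+-assoc (f x) _ _))

∑-map : ∀ {A B : Set} (g : A → B) xs f → ∑ (map g xs) f ≡ ∑ xs (f ∘ g)
∑-map g []       f = refl
∑-map g (x ∷ xs) f = cong (λ s → f (g x) + s) (∑-map g xs f)

∑-concatMap : ∀ {A B : Set} (g : A → List B) xs f → ∑ (concatMap g xs) f ≡ ∑ xs (λ x → ∑ (g x) f)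
∑-concatMap g []       f = refl
∑-concatMap g (x ∷ xs) f = trans (∑-++ (g x) (concatMap g xs) f) (cong (λ s → ∑ (g x) f + s) (∑-concatMap g xs f))

∑-cong : ∀ {A : Set} xs {f g : A → ℤ} → (∀ x → f x ≡ g x) → ∑ xs f ≡ ∑ xs g
∑-cong []       f≗g = refl
∑-cong (x ∷ xs) f≗g = cong₂ _+_ (f≗g x) (∑-cong xs f≗g)

∑-+ : ∀ {A : Set} xs (f g : A → ℤ) → ∑ xs (λ x → f x + g x) ≡ ∑ xs f + ∑ xs g
∑-+ []       f g = refl
∑-+ (x ∷ xs) f g = trans (cong (λ s → f x + g x + s) (∑-+ xs f g)) (interchange (f x) (g x) _ _)
  where
  interchange : ∀ a b c d → (a + b) + (c + d) ≡ (a + c) + (b + d)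
  interchange = solve-∀

∑-zero : ∀ {A : Set} xs {f : A → ℤ} → (∀ x → f x ≡ + 0) → ∑ xs f ≡ + 0
∑-zero []       f≡0 = refl
∑-zero (x ∷ xs) f≡0 = cong₂ _+_ (f≡0 x) (∑-zero xs f≡0)

∑-if : ∀ {A : Set} b (x : A) f → ∑ (if b then x ∷ [] else []) f ≡ (if b then f x else + 0)
∑-if true  x f = +-identityʳ (f x)
∑-if false x f = refl

∑-allSubsets-suc : ∀ n (f : Subset (suc n) → ℤ) →
                   ∑ (allSubsets (suc n)) f ≡ ∑ (allSubsets n) (f ∘ (false ∷_)) + ∑ (allSubsets n) (f ∘ (true ∷_))
∑-allSubsets-suc n f =
  trans (∑-++ (map (false ∷_) (allSubsets n)) _ f) (cong₂ _+_ (∑-map _ (allSubsets n) f) (∑-map _ (allSubsets n) f))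

∑∑ : ∀ n → (Subset n → Subset n → ℤ) → ℤ
∑∑ n f = ∑ (allSubsets n) λ X → ∑ (allSubsets n) (f X)

∑∑-+ : ∀ n (f g : Subset n → Subset n → ℤ) → ∑∑ n (λ X Y → f X Y + g X Y) ≡ ∑∑ n f + ∑∑ n g
∑∑-+ n f g = trans (∑-cong (allSubsets n) (λ X → ∑-+ (allSubsets n) (f X) (g X))) (∑-+ (allSubsets n) (λ X → ∑ (allSubsets n) (f X)) (λ X → ∑ (allSubsets n) (g X)))

∑∑-zero : ∀ n {f : Subset n → Subset n → ℤ} → (∀ X Y → f X Y ≡ + 0) → ∑∑ n f ≡ + 0
∑∑-zero n f≡0 = ∑-zero (allSubsets n) (λ X → ∑-zero (allSubsets n) (f≡0 X))

∑∑-suc : ∀ n (f : Subset (suc n) → Subset (suc n) → ℤ) →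
         ∑∑ (suc n) f ≡ ∑∑ n (λ X Y → f (false ∷ X) (false ∷ Y) + f (false ∷ X) (true ∷ Y)
                                     + f (true ∷ X) (false ∷ Y) + f (true ∷ X) (true ∷ Y))
∑∑-suc n f = begin
  ∑∑ (suc n) f
    ≡⟨ ∑-cong (allSubsets (suc n)) (λ X → ∑-allSubsets-suc n (f X)) ⟩
  ∑ (allSubsets (suc n)) (λ X → ∑ all (f X ∘ (false ∷_)) + ∑ all (f X ∘ (true ∷_)))
    ≡⟨ ∑-allSubsets-suc n (λ X → ∑ all (f X ∘ (false ∷_)) + ∑ all (f X ∘ (true ∷_))) ⟩
  ∑ all (λ X → ∑ all (f₀₀ X) + ∑ all (f₀₁ X)) + ∑ all (λ X → ∑ all (f₁₀ X) + ∑ all (f₁₁ X))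
    ≡⟨ cong₂ _+_ (∑-+ all (λ X → ∑ all (f₀₀ X)) (λ X → ∑ all (f₀₁ X)))
                 (∑-+ all (λ X → ∑ all (f₁₀ X)) (λ X → ∑ all (f₁₁ X))) ⟩
  (∑∑ n f₀₀ + ∑∑ n f₀₁) + (∑∑ n f₁₀ + ∑∑ n f₁₁)
    ≡⟨ sym (+-assoc (∑∑ n f₀₀ + ∑∑ n f₀₁) _ _) ⟩
  ∑∑ n f₀₀ + ∑∑ n f₀₁ + ∑∑ n f₁₀ + ∑∑ n f₁₁
    ≡⟨ sym (cong (λ s → s + ∑∑ n f₁₀ + ∑∑ n f₁₁) (∑∑-+ n f₀₀ f₀₁)) ⟩
  ∑∑ n (λ X Y → f₀₀ X Y + f₀₁ X Y) + ∑∑ n f₁₀ + ∑∑ n f₁₁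
    ≡⟨ sym (cong (_+ ∑∑ n f₁₁) (∑∑-+ n (λ X Y → f₀₀ X Y + f₀₁ X Y) f₁₀)) ⟩
  ∑∑ n (λ X Y → f₀₀ X Y + f₀₁ X Y + f₁₀ X Y) + ∑∑ n f₁₁
    ≡⟨ sym (∑∑-+ n (λ X Y → f₀₀ X Y + f₀₁ X Y + f₁₀ X Y) f₁₁) ⟩
  ∑∑ n (λ X Y → f₀₀ X Y + f₀₁ X Y + f₁₀ X Y + f₁₁ X Y) ∎
  where
  open ≡-Reasoning
  all = allSubsets n
  f₀₀ f₀₁ f₁₀ f₁₁ : Subset n → Subset n → ℤ
  f₀₀ X Y = f (false ∷ X) (false ∷ Y)
  f₀₁ X Y = f (false ∷ X) (true ∷ Y)
  f₁₀ X Y = f (true ∷ X) (false ∷ Y)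
  f₁₁ X Y = f (true ∷ X) (true ∷ Y)

disjointTerm : ∀ {n} → SetSystem n → ℤ → Subset n → Subset n → ℤ
disjointTerm M y X Y = if disjointᵇ X Y then powM y (dist ((M * Y) *̄ˢ X)) else + 0

Q₁≡∑∑ : ∀ {n} (M : SetSystem n) y → Q₁ M y ≡ ∑∑ n (disjointTerm M y)
Q₁≡∑∑ {n} M y = begin
  ∑ (disjointPairs n) term
    ≡⟨ ∑-concatMap (λ X → concatMap (pairIfDisjoint X) (allSubsets n)) (allSubsets n) term ⟩
  ∑ (allSubsets n) (λ X → ∑ (concatMap (pairIfDisjoint X) (allSubsets n)) term)
    ≡⟨ ∑-cong (allSubsets n) (λ X → ∑-concatMap (pairIfDisjoint X) (allSubsets n) term) ⟩
  ∑ (allSubsets n) (λ X → ∑ (allSubsets n) (λ Y → ∑ (pairIfDisjoint X Y) term))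
    ≡⟨ ∑-cong (allSubsets n) (λ X → ∑-cong (allSubsets n) (λ Y → ∑-if (disjointᵇ X Y) (X , Y) term)) ⟩
  ∑∑ n (disjointTerm M y) ∎
  where
  open ≡-Reasoning
  term : Subset n × Subset n → ℤ
  term (X , Y) = powM y (dist ((M * Y) *̄ˢ X))
  pairIfDisjoint : Subset n → Subset n → List (Subset n × Subset n)
  pairIfDisjoint X Y = if disjointᵇ X Y then (X , Y) ∷ [] else []

disjointTerms-cancel : ∀ {m} (M : SetSystem (suc m)) → IsVFClosedΔMatroid M → ∀ X Y →
  disjointTerm M -[1+ 1 ] (false ∷ X) (false ∷ Y) + disjointTerm M -[1+ 1 ] (false ∷ X) (true ∷ Y)
  + disjointTerm M -[1+ 1 ] (true ∷ X) (false ∷ Y) + disjointTerm M -[1+ 1 ] (true ∷ X) (true ∷ Y) ≡ + 0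
disjointTerms-cancel {m} M vf X Y with disjointᵇ X Y
... | false = refl
... | true  = begin
  powM -[1+ 1 ] (dist (K *̄ˢ (false ∷ X))) + powM -[1+ 1 ] (dist ((M * (true ∷ Y)) *̄ˢ (false ∷ X)))
    + powM -[1+ 1 ] (dist (K *̄ˢ (true ∷ X))) + + 0
    ≡⟨ +-identityʳ _ ⟩
  powM -[1+ 1 ] (dist (K *̄ˢ (false ∷ X))) + powM -[1+ 1 ] (dist ((M * (true ∷ Y)) *̄ˢ (false ∷ X)))
    + powM -[1+ 1 ] (dist (K *̄ˢ (true ∷ X)))
    ≡⟨ cong₂ _+_ (cong₂ _+_ (cong (powM -[1+ 1 ]) dist-T) (cong (powM -[1+ 1 ]) dist-T*ₑ0))
                 (cong (powM -[1+ 1 ]) dist-T*̄0) ⟩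
  powM -[1+ 1 ] (dist T) + powM -[1+ 1 ] (dist (T *ₑ zero)) + powM -[1+ 1 ] (dist (T *̄ zero))
    ≡⟨ cancel-−2-powers (dists-OneExceedsByOne {N = T} (vfClosed-T [])) ⟩
  + 0 ∎
  where
  open ≡-Reasoning
  K T : SetSystem (suc m)
  K = M * (false ∷ Y)
  T = K *̄ˢ-suc X

  vfClosed-T : IsVFClosedΔMatroid T
  vfClosed-T = subst IsVFClosedΔMatroid (*̄ˢ-false∷ K X) (vfClosed-*̄ˢ (false ∷ X) (vfClosed-* (false ∷ Y) vf))

  M*1Y≗K*ₑ0 : (M * (true ∷ Y)) ≗ (K *ₑ zero)
  M*1Y≗K*ₑ0 Z = trans (cong (λ B → M (Z ⊕ (true ∷ B))) (sym (⊕-identityˡ Y))) (sym (*-* M (false ∷ Y) ⁅ zero ⁆ Z))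

  dist-T : dist (K *̄ˢ (false ∷ X)) ≡ dist T
  dist-T = cong dist (*̄ˢ-false∷ K X)

  dist-T*ₑ0 : dist ((M * (true ∷ Y)) *̄ˢ (false ∷ X)) ≡ dist (T *ₑ zero)
  dist-T*ₑ0 = trans (cong dist (*̄ˢ-false∷ (M * (true ∷ Y)) X)) (dist-≗ (*̄ˢ-suc-*ₑzero X M*1Y≗K*ₑ0))

  dist-T*̄0 : dist (K *̄ˢ (true ∷ X)) ≡ dist (T *̄ zero)
  dist-T*̄0 = cong dist (*̄ˢ-true∷ K X)

theorem26 : ∀ (m : ℕ) (M : SetSystem (suc m)) → IsVFClosedΔMatroid M → Q₁ M -[1+ 1 ] ≡ + 0
theorem26 m M vf =
  trans (Q₁≡∑∑ M -[1+ 1 ])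
        (trans (∑∑-suc m (disjointTerm M -[1+ 1 ])) (∑∑-zero m (disjointTerms-cancel M vf)))
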